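{- Let $u\in\{0,1\}^*$. Then $$\#\left\{v\in L_2 : \binom{100u}{v}>0\right\}=2\cdot\#\left\{v\in L_2 : \binom{10u}{v}>0\right\}-\#\left\{v\in L_2 : \binom{1u}{v}>0\right\}.$$
   Context: For finite words $u,v$ over $\{0,1\}$, $\binom{u}{v}$ is the number of occurrences of $v$ as a (scattered) subword (subsequence) of $u$. $L_2=\{\varepsilon\}\cup 1\{0,1\}^*$. -}

module Defs where

open import Data.Nat using (ℕ; zero; suc; _+_; _<_; _<ᵇ_)
open import Data.Bool using (Bool; true; false; _∧_; if_then_else_)
open import Data.List using (List; []; _∷_; length; map; _++_; concatMap; filterᵇ)
open import Data.Fin using (Fin)

Bit : Set
Bit = Fin 2

b0 b1 : Bit
b0 = Fin.zero
b1 = Fin.suc Fin.zero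

Word : Set
Word = List Bit

eqBit : Bit → Bit → Bool
eqBit Fin.zero Fin.zero = true
eqBit (Fin.suc Fin.zero) (Fin.suc Fin.zero) = true
eqBit _ _ = false

binom : Word → Word → ℕ
binom u [] = 1
binom [] (b ∷ v) = 0
binom (a ∷ u) (b ∷ v) = (if eqBit a b then binom u v else 0) + binom u (b ∷ v)

inL2 : Word → Bool
inL2 [] = true
inL2 (Fin.zero ∷ _) = false
inL2 (Fin.suc _ ∷ _) = true

wordsOfLength : ℕ → List Word
wordsOfLength zero = [] ∷ []
wordsOfLength (suc n) = concatMap (λ w → (b0 ∷ w) ∷ (b1 ∷ w) ∷ []) (wordsOfLength n)

wordsUpTo : ℕ → List Word
wordsUpTo zero = wordsOfLength zero
wordsUpTo (suc n) = wordsUpTo n ++ wordsOfLength (suc n)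

-- #{ v ∈ L2 : binom w v > 0 }.  Any v with binom w v > 0 has length ≤ |w|,
-- so enumerating words of length ≤ |w| covers the whole (finite) set.
countL2 : Word → ℕ
countL2 w = length (filterᵇ (λ v → inL2 v ∧ (0 <ᵇ binom w v)) (wordsUpTo (length w)))

-- Let S w be the number of distinct subwords of w (ε included) and T w the
-- number of v such that 1v is a subword of w.  A word of L₂ occurring in 1w is
-- either ε or 1v with v occurring in w, so the count for 1w is 1 + S w.
-- Sorting the subwords of 0w by their first letter gives S (0w) = 1 + S w + T w,
-- and T (0w) = T w because a match of 1v never uses a leading 0.  The identity
-- is then linear arithmetic in S u and T u.
module Submission where

open import Defs
open import Data.Nat using (ℕ; zero; suc; _+_; _*_; _<_; _≤_; _<ᵇ_; z≤n; s≤s)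
open import Data.Nat.Properties
  using (+-identityʳ; +-assoc; ≤-refl; m≤n+m; <-≤-trans; m≤n⇒m≤1+n; n≤1+n)
open import Data.Nat.Tactic.RingSolver using (solve-∀)
open import Data.Bool using (Bool; true; false; _∧_; if_then_else_)
open import Data.List using (List; []; _∷_; length; _++_; concatMap; filterᵇ)
open import Data.Sum using (_⊎_; inj₁; inj₂; [_,_])
open import Function using (_∘_; id)
open import Relation.Binary.PropositionalEquality
  using (_≡_; refl; sym; trans; cong; cong₂; subst; module ≡-Reasoning)

open ≡-Reasoning

private
  variable
    A : Set

⟦_⟧ : Bool → ℕ
⟦ true ⟧  = 1
⟦ false ⟧ = 0

count : (A → Bool) → List A → ℕ
count P []       = 0
count P (x ∷ xs) = ⟦ P x ⟧ + count P xs

length-filterᵇ : (P : A → Bool) (xs : List A) → length (filterᵇ P xs) ≡ count P xs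
length-filterᵇ P []       = refl
length-filterᵇ P (x ∷ xs) with P x
... | true  = cong suc (length-filterᵇ P xs)
... | false = length-filterᵇ P xs

count-++ : (P : A → Bool) (xs ys : List A) → count P (xs ++ ys) ≡ count P xs + count P ys
count-++ P []       ys = refl
count-++ P (x ∷ xs) ys =
  trans (cong (⟦ P x ⟧ +_) (count-++ P xs ys)) (sym (+-assoc ⟦ P x ⟧ _ _))

count-cong : {P Q : A → Bool} (xs : List A) → (∀ x → P x ≡ Q x) → count P xs ≡ count Q xs
count-cong []       P≡Q = refl
count-cong (x ∷ xs) P≡Q = cong₂ _+_ (cong ⟦_⟧ (P≡Q x)) (count-cong xs P≡Q)

count-false : (xs : List A) → count (λ _ → false) xs ≡ 0
count-false []       = refl
count-false (x ∷ xs) = count-false xs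

count-concatMap-pair : (P : A → Bool) (f g : A → A) (xs : List A) →
  count P (concatMap (λ x → f x ∷ g x ∷ []) xs) ≡ count (P ∘ f) xs + count (P ∘ g) xs
count-concatMap-pair P f g []       = refl
count-concatMap-pair P f g (x ∷ xs) =
  trans (cong (λ n → ⟦ P (f x) ⟧ + (⟦ P (g x) ⟧ + n)) (count-concatMap-pair P f g xs))
        (interchange ⟦ P (f x) ⟧ ⟦ P (g x) ⟧ _ _)
  where
  interchange : (a b c d : ℕ) → a + (b + (c + d)) ≡ (a + c) + (b + d)
  interchange = solve-∀

countOfLength : ℕ → (Word → Bool) → ℕ
countOfLength n P = count P (wordsOfLength n)

countUpTo : ℕ → (Word → Bool) → ℕ
countUpTo n P = count P (wordsUpTo n)

countUpTo-cong : ∀ n {P Q : Word → Bool} → (∀ v → P v ≡ Q v) → countUpTo n P ≡ countUpTo n Q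
countUpTo-cong n = count-cong (wordsUpTo n)

countOfLength-suc : ∀ n P →
  countOfLength (suc n) P ≡ countOfLength n (P ∘ (b0 ∷_)) + countOfLength n (P ∘ (b1 ∷_))
countOfLength-suc n P = count-concatMap-pair P (b0 ∷_) (b1 ∷_) (wordsOfLength n)

countUpTo-suc-++ : ∀ n P → countUpTo (suc n) P ≡ countUpTo n P + countOfLength (suc n) P
countUpTo-suc-++ n P = count-++ P (wordsUpTo n) (wordsOfLength (suc n))

countUpTo-suc : ∀ n P →
  countUpTo (suc n) P ≡ ⟦ P [] ⟧ + countUpTo n (P ∘ (b0 ∷_)) + countUpTo n (P ∘ (b1 ∷_))
countUpTo-suc zero P = begin
    countUpTo 1 P
  ≡⟨ countUpTo-suc-++ 0 P ⟩
    (⟦ P [] ⟧ + 0) + countOfLength 1 P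
  ≡⟨ cong₂ _+_ (+-identityʳ ⟦ P [] ⟧) (countOfLength-suc 0 P) ⟩
    ⟦ P [] ⟧ + (countUpTo 0 (P ∘ (b0 ∷_)) + countUpTo 0 (P ∘ (b1 ∷_)))
  ≡⟨ sym (+-assoc ⟦ P [] ⟧ _ _) ⟩
    ⟦ P [] ⟧ + countUpTo 0 (P ∘ (b0 ∷_)) + countUpTo 0 (P ∘ (b1 ∷_)) ∎
countUpTo-suc (suc n) P = begin
    countUpTo (suc (suc n)) P
  ≡⟨ countUpTo-suc-++ (suc n) P ⟩
    countUpTo (suc n) P + countOfLength (suc (suc n)) P
  ≡⟨ cong₂ _+_ (countUpTo-suc n P) (countOfLength-suc (suc n) P) ⟩
    (⟦ P [] ⟧ + countUpTo n P₀ + countUpTo n P₁)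
      + (countOfLength (suc n) P₀ + countOfLength (suc n) P₁)
  ≡⟨ interchange ⟦ P [] ⟧ _ _ _ _ ⟩
    ⟦ P [] ⟧ + (countUpTo n P₀ + countOfLength (suc n) P₀)
             + (countUpTo n P₁ + countOfLength (suc n) P₁)
  ≡⟨ sym (cong₂ (λ a b → ⟦ P [] ⟧ + a + b) (countUpTo-suc-++ n P₀) (countUpTo-suc-++ n P₁)) ⟩
    ⟦ P [] ⟧ + countUpTo (suc n) P₀ + countUpTo (suc n) P₁ ∎
  where
  P₀ P₁ : Word → Bool
  P₀ = P ∘ (b0 ∷_)
  P₁ = P ∘ (b1 ∷_)
  interchange : (p a b c d : ℕ) → (p + a + b) + (c + d) ≡ p + (a + c) + (b + d)
  interchange = solve-∀

countOfLength-vanishing : ∀ n P → (∀ v → length v ≡ n → P v ≡ false) → countOfLength n P ≡ 0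
countOfLength-vanishing zero P vanish = cong (λ b → ⟦ b ⟧ + 0) (vanish [] refl)
countOfLength-vanishing (suc n) P vanish = trans (countOfLength-suc n P)
  (cong₂ _+_ (countOfLength-vanishing n (P ∘ (b0 ∷_)) (λ v eq → vanish (b0 ∷ v) (cong suc eq)))
             (countOfLength-vanishing n (P ∘ (b1 ∷_)) (λ v eq → vanish (b1 ∷ v) (cong suc eq))))

countUpTo-suc-vanishing : ∀ n P → (∀ v → length v ≡ suc n → P v ≡ false) →
  countUpTo (suc n) P ≡ countUpTo n P
countUpTo-suc-vanishing n P vanish = begin
    countUpTo (suc n) P
  ≡⟨ countUpTo-suc-++ n P ⟩
    countUpTo n P + countOfLength (suc n) P
  ≡⟨ cong (countUpTo n P +_) (countOfLength-vanishing (suc n) P vanish) ⟩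
    countUpTo n P + 0
  ≡⟨ +-identityʳ _ ⟩
    countUpTo n P ∎

occurs : Word → Word → Bool
occurs w v = 0 <ᵇ binom w v

binom-mono-∷ : ∀ a u v → binom u v ≤ binom (a ∷ u) v
binom-mono-∷ a u []      = ≤-refl
binom-mono-∷ a u (b ∷ v) with eqBit a b
... | true  = m≤n+m (binom u (b ∷ v)) (binom u v)
... | false = ≤-refl

positive-+ : ∀ m n → 0 < m + n → 0 < m ⊎ 0 < n
positive-+ zero    n 0<n = inj₂ 0<n
positive-+ (suc m) n _   = inj₁ (s≤s z≤n)

binom-tail-pos : ∀ u b v → 0 < binom u (b ∷ v) → 0 < binom u v
binom-tail-pos (a ∷ u) b v 0<binom = <-≤-trans (tail-pos (eqBit a b) 0<binom) (binom-mono-∷ a u v)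
  where
  tail-pos : ∀ c → 0 < (if c then binom u v else 0) + binom u (b ∷ v) → 0 < binom u v
  tail-pos true  h = [ id , binom-tail-pos u b v ] (positive-+ (binom u v) _ h)
  tail-pos false h = binom-tail-pos u b v h

0<ᵇ-+-dominated : ∀ m n → (0 < n → 0 < m) → (0 <ᵇ m + n) ≡ (0 <ᵇ m)
0<ᵇ-+-dominated zero    zero    n⇒m = refl
0<ᵇ-+-dominated zero    (suc n) n⇒m with n⇒m (s≤s z≤n)
... | ()
0<ᵇ-+-dominated (suc m) n       n⇒m = refl

occurs-∷ : ∀ a u b v → occurs (a ∷ u) (b ∷ v) ≡ (if eqBit a b then occurs u v else occurs u (b ∷ v))
occurs-∷ a u b v with eqBit a b
... | true  = 0<ᵇ-+-dominated (binom u v) (binom u (b ∷ v)) (binom-tail-pos u b v)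
... | false = refl

occurs-long : ∀ u v → length u < length v → occurs u v ≡ false
occurs-long []      (b ∷ v) _          = refl
occurs-long (a ∷ u) (b ∷ v) (s≤s |u|<|v|) = trans (occurs-∷ a u b v) (by-match (eqBit a b))
  where
  by-match : ∀ c → (if c then occurs u v else occurs u (b ∷ v)) ≡ false
  by-match true  = occurs-long u v |u|<|v|
  by-match false = occurs-long u (b ∷ v) (m≤n⇒m≤1+n |u|<|v|)

nSubwords : Word → ℕ
nSubwords u = countUpTo (length u) (occurs u)

nSubwords₁ : Word → ℕ
nSubwords₁ u = countUpTo (length u) (λ v → occurs u (b1 ∷ v))

countL2-1∷ : ∀ u → countL2 (b1 ∷ u) ≡ suc (nSubwords u)
countL2-1∷ u = begin
    countL2 (b1 ∷ u)
  ≡⟨ length-filterᵇ _ (wordsUpTo (suc (length u))) ⟩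
    countUpTo (suc (length u)) (λ v → inL2 v ∧ occurs (b1 ∷ u) v)
  ≡⟨ countUpTo-suc (length u) _ ⟩
    1 + count (λ _ → false) (wordsUpTo (length u))
      + countUpTo (length u) (λ v → occurs (b1 ∷ u) (b1 ∷ v))
  ≡⟨ cong₂ (λ a b → 1 + a + b) (count-false (wordsUpTo (length u)))
                                (countUpTo-cong (length u) (occurs-∷ b1 u b1)) ⟩
    suc (nSubwords u) ∎

nSubwords-0∷ : ∀ u → nSubwords (b0 ∷ u) ≡ suc (nSubwords u + nSubwords₁ u)
nSubwords-0∷ u = trans (countUpTo-suc (length u) (occurs (b0 ∷ u)))
  (cong₂ (λ a b → 1 + a + b) (countUpTo-cong (length u) (occurs-∷ b0 u b0))
                              (countUpTo-cong (length u) (occurs-∷ b0 u b1)))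

nSubwords₁-0∷ : ∀ u → nSubwords₁ (b0 ∷ u) ≡ nSubwords₁ u
nSubwords₁-0∷ u = trans (countUpTo-cong (suc (length u)) (occurs-∷ b0 u b1))
  (countUpTo-suc-vanishing (length u) _ too-long)
  where
  too-long : ∀ v → length v ≡ suc (length u) → occurs u (b1 ∷ v) ≡ false
  too-long v |v|≡1+|u| = occurs-long u (b1 ∷ v) (s≤s (subst (length u ≤_) (sym |v|≡1+|u|) (n≤1+n _)))

lemma3p3 : (u : Word) →
    countL2 (b1 ∷ b0 ∷ b0 ∷ u) + countL2 (b1 ∷ u) ≡ 2 * countL2 (b1 ∷ b0 ∷ u)
lemma3p3 u
  rewrite countL2-1∷ (b0 ∷ b0 ∷ u) | countL2-1∷ u | countL2-1∷ (b0 ∷ u)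
        | nSubwords-0∷ (b0 ∷ u) | nSubwords₁-0∷ u | nSubwords-0∷ u
  = arithmetic (nSubwords u) (nSubwords₁ u)
  where
  arithmetic : (s t : ℕ) → suc (suc (suc (s + t) + t)) + suc s ≡ 2 * suc (suc (s + t))
  arithmetic = solve-∀
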